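{- Let $D$ be the derivation of the polynomial ring $\mathbb{Q}[y,z]$ determined by $D(y)=z^2$ and $D(z)=yz$ (this models $D=d/dx$ with $y=\tan x$, $z=\sec x$). Define operators $(Dz)^n$ on $\mathbb{Q}[y,z]$ by $(Dz)^0(f)=f$ and $(Dz)^{n+1}(f)=D\big(z\,(Dz)^n(f)\big)$ for $n\ge 0$. Define numbers $M(n,k)$ and $N(n,k)$ by the expansions $$(Dz)^n(z)=\sum_{k=0}^{\lfloor n/2\rfloor}M(n,k)\,y^{n-2k}z^{n+2k+1},\qquad (Dz)^n(y)=\sum_{k=0}^{\lfloor (n+1)/2\rfloor}N(n,k)\,y^{n-2k+1}z^{n+2k},$$ with the convention that $M(n,k)=N(n,k)=0$ for $k<0$ or $k$ outside the indicated summation ranges. Then for $0\le k\le \lfloor n/2\rfloor$, $$M(n+1,k)=(n+2k+2)M(n,k)+(n-2k+2)M(n,k-1),$$ with $M(0,0)=1$ and $M(0,k)=0$ for $k\ge1$; and $$N(n+1,k)=(n+2k+1)N(n,k)+(n-2k+3)N(n,k-1),$$ with $N(0,0)=1$ and $N(0,k)=0$ for $k\ge 1$.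
   Context: The expansions are understood formally in the polynomial ring $\mathbb{Q}[y,z]$ (where $y,z$ are independent indeterminates), so the coefficients $M(n,k)$ and $N(n,k)$ are uniquely determined. For example $(Dz)(z)=2yz^2$ and $(Dz)(y)=y^2z+z^3$. -}

module Defs where

open import Data.Nat as ℕ using (ℕ; zero; suc; _≤ᵇ_; _∸_)
open import Data.Integer as ℤ using (ℤ; +_; -[1+_])
open import Data.Rational using (ℚ; 0ℚ; 1ℚ; _/_; _+_; _*_)
open import Data.Bool using (if_then_else_)

-- An element of ℚ[y,z], represented by its coefficient function:
-- P a b = coefficient of the monomial y^a z^b.
-- (Only finitely supported P are polynomials; all inputs used below are.)
Poly : Set
Poly = ℕ → ℕ → ℚ

ℕ→ℚ : ℕ → ℚ
ℕ→ℚ n = + n / 1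

ℤ→ℚ : ℤ → ℚ
ℤ→ℚ i = i / 1

yP : Poly
yP 1 0 = 1ℚ
yP _ _ = 0ℚ

zP : Poly
zP 0 1 = 1ℚ
zP _ _ = 0ℚ

mulZ : Poly → Poly
mulZ f a zero    = 0ℚ
mulZ f a (suc b) = f a b

-- The derivation D of ℚ[y,z] with D(y) = z^2, D(z) = y z, written out on
-- coefficients:  D(y^a z^b) = a y^(a-1) z^(b+2) + b y^(a+1) z^b,
-- extended linearly.
D : Poly → Poly
D f a b = t₁ a b + t₂ a b
  where
  t₁ : ℕ → ℕ → ℚ
  t₁ a (suc (suc b)) = ℕ→ℚ (suc a) * f (suc a) b
  t₁ a _             = 0ℚ
  t₂ : ℕ → ℕ → ℚ
  t₂ zero    b = 0ℚ
  t₂ (suc a) b = ℕ→ℚ b * f a b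

DzPow : ℕ → Poly → Poly
DzPow zero    f = f
DzPow (suc n) f = D (mulZ (DzPow n f))

M : ℕ → ℤ → ℚ
M n (+ k)    = if k ≤ᵇ (n ℕ./ 2) then DzPow n zP (n ∸ 2 ℕ.* k) (n ℕ.+ 2 ℕ.* k ℕ.+ 1) else 0ℚ
M n -[1+ _ ] = 0ℚ

N : ℕ → ℤ → ℚ
N n (+ k)    = if k ≤ᵇ (suc n ℕ./ 2) then DzPow n yP (suc n ∸ 2 ℕ.* k) (n ℕ.+ 2 ℕ.* k) else 0ℚ
N n -[1+ _ ] = 0ℚ

module Submission where

-- Write  T f = D (z f)  for one step of the iteration, so that
-- (Dz)^(n+1) f = T ((Dz)^n f).  Reading off the definition of D, the coefficient
-- of y^(a+1) z^(b+3) in T f is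
--     (b+3) · [y^a z^(b+2)] f  +  (a+2) · [y^(a+2) z^b] f,
-- which is exactly the shape of the two recurrences: the first summand
-- carries M(n,k) (resp. N(n,k)), the second M(n,k-1) (resp. N(n,k-1)).
-- For k = 0 the second summand is a coefficient beyond the y-degree of f,
-- so we also record that T raises the y-degree by at most one, whence
-- (Dz)^n(z) and (Dz)^n(y) have y-degree ≤ n and ≤ n+1.

open import Defs
open import Data.Nat as ℕ using (ℕ; zero; suc; _≤_; _<_; s≤s)
open import Data.Integer as ℤ using (+_)
open import Data.Rational using (ℚ; 0ℚ; 1ℚ; _+_; _*_)
open import Data.Product using (_×_; _,_)
open import Data.Bool using (Bool; true; T; if_then_else_)
open import Relation.Binary.PropositionalEquality
  using (_≡_; refl; sym; trans; cong; cong₂; module ≡-Reasoning)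
import Data.Nat.Properties as ℕP
import Data.Integer.Properties as ℤP
import Data.Rational.Properties as ℚP
open import Data.Nat.DivMod using (/-monoˡ-≤; m/n*n≤m)
open import Data.Nat.Solver using (module +-*-Solver)
open +-*-Solver using (solve; _:+_; _:*_; con; _:=_)

T-step : Poly → Poly
T-step f = D (mulZ f)

YDeg≤ : ℕ → Poly → Set
YDeg≤ c f = ∀ a b → c < a → f a b ≡ 0ℚ

mulZ-YDeg : ∀ {c f} → YDeg≤ c f → YDeg≤ c (mulZ f)
mulZ-YDeg deg a zero    _   = refl
mulZ-YDeg deg a (suc b) c<a = deg a b c<a

drop-zeroˡ : ∀ {x} y → x ≡ 0ℚ → x + y ≡ y
drop-zeroˡ y x≡0 = trans (cong (_+ y) x≡0) (ℚP.+-identityˡ y)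

-- Coefficient of T f near the top y-degree: the term D(y^(a+2) …) would need
-- a coefficient of f of y-degree a+2 > c, so only z-differentiation contributes.
T-top : ∀ {c f} → YDeg≤ c f → ∀ a b → c < suc (suc a) →
        T-step f (suc a) b ≡ ℕ→ℚ b * mulZ f a b
T-top deg a zero                _ = ℚP.+-identityˡ _
T-top deg a (suc zero)          _ = ℚP.+-identityˡ _
T-top deg a (suc (suc b)) c<a+2 =
  drop-zeroˡ _ (trans (cong (ℕ→ℚ (suc (suc a)) *_) (mulZ-YDeg deg (suc (suc a)) b c<a+2))
                      (ℚP.*-zeroʳ (ℕ→ℚ (suc (suc a)))))

T-interior : ∀ f a b →
  T-step f (suc a) (3 ℕ.+ b) ≡ ℕ→ℚ (3 ℕ.+ b) * f a (2 ℕ.+ b) + ℕ→ℚ (2 ℕ.+ a) * f (2 ℕ.+ a) b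
T-interior f a b = ℚP.+-comm (ℕ→ℚ (2 ℕ.+ a) * f (2 ℕ.+ a) b) (ℕ→ℚ (3 ℕ.+ b) * f a (2 ℕ.+ b))

T-YDeg : ∀ {c f} → YDeg≤ c f → YDeg≤ (suc c) (T-step f)
T-YDeg {f = f} deg (suc a) b (s≤s c<a) = begin
  T-step f (suc a) b       ≡⟨ T-top deg a b (ℕP.m<n⇒m<1+n (ℕP.m<n⇒m<1+n c<a)) ⟩
  ℕ→ℚ b * mulZ f a b       ≡⟨ cong (ℕ→ℚ b *_) (mulZ-YDeg deg a b c<a) ⟩
  ℕ→ℚ b * 0ℚ               ≡⟨ ℚP.*-zeroʳ (ℕ→ℚ b) ⟩
  0ℚ                       ∎
  where open ≡-Reasoning

YDeg-mono : ∀ {c d f} → c ≤ d → YDeg≤ c f → YDeg≤ d f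
YDeg-mono c≤d deg a b d<a = deg a b (ℕP.≤-<-trans c≤d d<a)

DzPow-YDeg : ∀ {c f} n → YDeg≤ c f → YDeg≤ (c ℕ.+ n) (DzPow n f)
DzPow-YDeg zero    deg = YDeg-mono (ℕP.m≤m+n _ 0) deg
DzPow-YDeg {c} (suc n) deg =
  YDeg-mono (ℕP.≤-reflexive (sym (ℕP.+-suc c n))) (T-YDeg (DzPow-YDeg n deg))

z-YDeg : YDeg≤ 0 zP
z-YDeg (suc a) b _ = refl

y-YDeg : YDeg≤ 1 yP
y-YDeg (suc zero)    b (s≤s ())
y-YDeg (suc (suc a)) b _ = refl

-- k ≤ ⌊n/2⌋ means 2k ≤ n, so the truncated subtraction n ∸ 2k is exact.
half-bound : ∀ n k → k ≤ n ℕ./ 2 → 2 ℕ.* k ≤ n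
half-bound n k k≤n/2 =
  ℕP.≤-trans (ℕP.*-monoʳ-≤ 2 k≤n/2)
             (ℕP.≤-trans (ℕP.≤-reflexive (ℕP.*-comm 2 (n ℕ./ 2))) (m/n*n≤m n 2))

half-mono : ∀ {n m} k → n ≤ m → k ≤ n ℕ./ 2 → k ≤ m ℕ./ 2
half-mono k n≤m k≤n/2 = ℕP.≤-trans k≤n/2 (/-monoˡ-≤ 2 n≤m)

+2*suc : ∀ n j → n ℕ.+ 2 ℕ.* suc j ≡ 2 ℕ.+ (n ℕ.+ 2 ℕ.* j)
+2*suc = solve 2 (λ n j → n :+ con 2 :* (con 1 :+ j) := con 2 :+ (n :+ con 2 :* j)) refl

∸2*suc : ∀ n j → 2 ℕ.* suc j ≤ n → n ℕ.∸ 2 ℕ.* j ≡ 2 ℕ.+ (n ℕ.∸ 2 ℕ.* suc j)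
∸2*suc n j 2k≤n = begin
  n ℕ.∸ 2 ℕ.* j                    ≡⟨ cong (ℕ._∸ 2 ℕ.* j) (sym (ℕP.m∸n+n≡m 2k≤n)) ⟩
  (m ℕ.+ 2 ℕ.* suc j) ℕ.∸ 2 ℕ.* j  ≡⟨ cong (ℕ._∸ 2 ℕ.* j) (regroup m j) ⟩
  (2 ℕ.+ m ℕ.+ 2 ℕ.* j) ℕ.∸ 2 ℕ.* j ≡⟨ ℕP.m+n∸n≡m (2 ℕ.+ m) (2 ℕ.* j) ⟩
  2 ℕ.+ m                          ∎
  where
  open ≡-Reasoning
  m = n ℕ.∸ 2 ℕ.* suc j
  regroup : ∀ m j → m ℕ.+ 2 ℕ.* suc j ≡ 2 ℕ.+ m ℕ.+ 2 ℕ.* j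
  regroup = solve 2 (λ m j → m :+ con 2 :* (con 1 :+ j) := con 2 :+ m :+ con 2 :* j) refl

coeff-plus : ∀ n k c → ℤ→ℚ (+ n ℤ.+ + 2 ℤ.* + k ℤ.+ + c) ≡ ℕ→ℚ (n ℕ.+ 2 ℕ.* k ℕ.+ c)
coeff-plus n k c = cong (λ e → ℤ→ℚ (+ n ℤ.+ e ℤ.+ + c)) (sym (ℤP.pos-* 2 k))

coeff-minus : ∀ n k c → 2 ℕ.* k ≤ n →
              ℤ→ℚ (+ n ℤ.- + 2 ℤ.* + k ℤ.+ + c) ≡ ℕ→ℚ (n ℕ.∸ 2 ℕ.* k ℕ.+ c)
coeff-minus n k c 2k≤n = cong (λ e → ℤ→ℚ (e ℤ.+ + c)) (begin
  + n ℤ.- + 2 ℤ.* + k    ≡⟨ cong (λ e → + n ℤ.- e) (sym (ℤP.pos-* 2 k)) ⟩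
  + n ℤ.- + (2 ℕ.* k)    ≡⟨ ℤP.m-n≡m⊖n n (2 ℕ.* k) ⟩
  n ℤ.⊖ 2 ℕ.* k          ≡⟨ ℤP.⊖-≥ 2k≤n ⟩
  + (n ℕ.∸ 2 ℕ.* k)      ∎)
  where open ≡-Reasoning

if-true : ∀ {b : Bool} {x : ℚ} → T b → (if b then x else 0ℚ) ≡ x
if-true {true} _ = refl

M-coeff : ∀ n k → k ≤ n ℕ./ 2 →
          M n (+ k) ≡ DzPow n zP (n ℕ.∸ 2 ℕ.* k) (n ℕ.+ 2 ℕ.* k ℕ.+ 1)
M-coeff n k k≤ = if-true (ℕP.≤⇒≤ᵇ k≤)

N-coeff : ∀ n k → k ≤ suc n ℕ./ 2 →
          N n (+ k) ≡ DzPow n yP (suc n ℕ.∸ 2 ℕ.* k) (n ℕ.+ 2 ℕ.* k)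
N-coeff n k k≤ = if-true (ℕP.≤⇒≤ᵇ k≤)

append-zero-term : ∀ x c → x ≡ x + c * 0ℚ
append-zero-term x c = sym (trans (cong (λ e → x + e) (ℚP.*-zeroʳ c)) (ℚP.+-identityʳ x))

M-recurrence : (n k : ℕ) → k ≤ n ℕ./ 2 →
  M (suc n) (+ k) ≡ ℤ→ℚ (+ n ℤ.+ + 2 ℤ.* + k ℤ.+ + 2) * M n (+ k)
                    + ℤ→ℚ (+ n ℤ.- + 2 ℤ.* + k ℤ.+ + 2) * M n (+ k ℤ.- + 1)
M-recurrence n zero k≤ = begin
  M (suc n) (+ 0)
    ≡⟨ M-coeff (suc n) 0 (half-mono 0 (ℕP.n≤1+n n) k≤) ⟩
  T-step (P n) (suc n) (suc (n ℕ.+ 0 ℕ.+ 1))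
    ≡⟨ T-top (DzPow-YDeg n z-YDeg) n (suc (n ℕ.+ 0 ℕ.+ 1)) (ℕP.n≤1+n (suc n)) ⟩
  ℕ→ℚ (suc (n ℕ.+ 0 ℕ.+ 1)) * P n n (n ℕ.+ 0 ℕ.+ 1)
    ≡⟨ cong₂ _*_ (trans (cong ℕ→ℚ (sym (ℕP.+-suc (n ℕ.+ 0) 1))) (sym (coeff-plus n 0 2)))
                 (sym (M-coeff n 0 k≤)) ⟩
  ℤ→ℚ (+ n ℤ.+ + 2 ℤ.* + 0 ℤ.+ + 2) * M n (+ 0)
    ≡⟨ append-zero-term _ (ℤ→ℚ (+ n ℤ.- + 2 ℤ.* + 0 ℤ.+ + 2)) ⟩
  ℤ→ℚ (+ n ℤ.+ + 2 ℤ.* + 0 ℤ.+ + 2) * M n (+ 0)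
    + ℤ→ℚ (+ n ℤ.- + 2 ℤ.* + 0 ℤ.+ + 2) * M n (+ 0 ℤ.- + 1) ∎
  where open ≡-Reasoning
        P = λ n → DzPow n zP
M-recurrence n (suc j) k≤ = begin
  M (suc n) (+ k)
    ≡⟨ M-coeff (suc n) k (half-mono k (ℕP.n≤1+n n) k≤) ⟩
  T-step (P n) (suc n ℕ.∸ 2 ℕ.* k) (suc n ℕ.+ 2 ℕ.* k ℕ.+ 1)
    ≡⟨ cong₂ (T-step (P n)) (ℕP.+-∸-assoc 1 2k≤n) (cong (λ e → suc (e ℕ.+ 1)) (+2*suc n j)) ⟩
  T-step (P n) (suc m) (3 ℕ.+ B)
    ≡⟨ T-interior (P n) m B ⟩
  ℕ→ℚ (3 ℕ.+ B) * P n m (2 ℕ.+ B) + ℕ→ℚ (2 ℕ.+ m) * P n (2 ℕ.+ m) B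
    ≡⟨ cong₂ _+_ (cong₂ _*_ (trans (cong ℕ→ℚ exponent) (sym (coeff-plus n k 2))) current)
                 (cong₂ _*_ (trans (cong ℕ→ℚ (ℕP.+-comm 2 m)) (sym (coeff-minus n k 2 2k≤n))) previous) ⟩
  ℤ→ℚ (+ n ℤ.+ + 2 ℤ.* + k ℤ.+ + 2) * M n (+ k)
    + ℤ→ℚ (+ n ℤ.- + 2 ℤ.* + k ℤ.+ + 2) * M n (+ k ℤ.- + 1) ∎
  where
  open ≡-Reasoning
  P = λ n → DzPow n zP
  k = suc j
  2k≤n = half-bound n k k≤
  j≤ = ℕP.≤-trans (ℕP.n≤1+n j) k≤
  m = n ℕ.∸ 2 ℕ.* k
  B = n ℕ.+ 2 ℕ.* j ℕ.+ 1
  exponent : 3 ℕ.+ B ≡ n ℕ.+ 2 ℕ.* k ℕ.+ 2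
  exponent = solve 2 (λ n j → con 3 :+ (n :+ con 2 :* j :+ con 1)
                            := n :+ con 2 :* (con 1 :+ j) :+ con 2) refl n j
  current : P n m (2 ℕ.+ B) ≡ M n (+ k)
  current = sym (trans (M-coeff n k k≤) (cong (λ e → P n m (e ℕ.+ 1)) (+2*suc n j)))
  previous : P n (2 ℕ.+ m) B ≡ M n (+ j)
  previous = sym (trans (M-coeff n j j≤) (cong (λ e → P n e B) (∸2*suc n j 2k≤n)))

N-recurrence : (n k : ℕ) → k ≤ n ℕ./ 2 →
  N (suc n) (+ k) ≡ ℤ→ℚ (+ n ℤ.+ + 2 ℤ.* + k ℤ.+ + 1) * N n (+ k)
                    + ℤ→ℚ (+ n ℤ.- + 2 ℤ.* + k ℤ.+ + 3) * N n (+ k ℤ.- + 1)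
N-recurrence n zero k≤ = begin
  N (suc n) (+ 0)
    ≡⟨ N-coeff (suc n) 0 (half-mono 0 (ℕP.m≤n+m n 2) k≤) ⟩
  T-step (Q n) (suc (suc n)) (suc (n ℕ.+ 0))
    ≡⟨ T-top (DzPow-YDeg n y-YDeg) (suc n) (suc (n ℕ.+ 0)) (ℕP.n≤1+n (suc (suc n))) ⟩
  ℕ→ℚ (suc (n ℕ.+ 0)) * Q n (suc n) (n ℕ.+ 0)
    ≡⟨ cong₂ _*_ (trans (cong ℕ→ℚ (ℕP.+-comm 1 (n ℕ.+ 0))) (sym (coeff-plus n 0 1)))
                 (sym (N-coeff n 0 (half-mono 0 (ℕP.n≤1+n n) k≤))) ⟩
  ℤ→ℚ (+ n ℤ.+ + 2 ℤ.* + 0 ℤ.+ + 1) * N n (+ 0)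
    ≡⟨ append-zero-term _ (ℤ→ℚ (+ n ℤ.- + 2 ℤ.* + 0 ℤ.+ + 3)) ⟩
  ℤ→ℚ (+ n ℤ.+ + 2 ℤ.* + 0 ℤ.+ + 1) * N n (+ 0)
    + ℤ→ℚ (+ n ℤ.- + 2 ℤ.* + 0 ℤ.+ + 3) * N n (+ 0 ℤ.- + 1) ∎
  where open ≡-Reasoning
        Q = λ n → DzPow n yP
N-recurrence n (suc j) k≤ = begin
  N (suc n) (+ k)
    ≡⟨ N-coeff (suc n) k (half-mono k (ℕP.m≤n+m n 2) k≤) ⟩
  T-step (Q n) (suc (suc n) ℕ.∸ 2 ℕ.* k) (suc n ℕ.+ 2 ℕ.* k)
    ≡⟨ cong₂ (T-step (Q n)) (ℕP.+-∸-assoc 2 2k≤n) (cong suc (+2*suc n j)) ⟩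
  T-step (Q n) (suc (suc m)) (3 ℕ.+ B)
    ≡⟨ T-interior (Q n) (suc m) B ⟩
  ℕ→ℚ (3 ℕ.+ B) * Q n (suc m) (2 ℕ.+ B) + ℕ→ℚ (3 ℕ.+ m) * Q n (3 ℕ.+ m) B
    ≡⟨ cong₂ _+_ (cong₂ _*_ (trans (cong ℕ→ℚ exponent) (sym (coeff-plus n k 1))) current)
                 (cong₂ _*_ (trans (cong ℕ→ℚ (ℕP.+-comm 3 m)) (sym (coeff-minus n k 3 2k≤n))) previous) ⟩
  ℤ→ℚ (+ n ℤ.+ + 2 ℤ.* + k ℤ.+ + 1) * N n (+ k)
    + ℤ→ℚ (+ n ℤ.- + 2 ℤ.* + k ℤ.+ + 3) * N n (+ k ℤ.- + 1) ∎
  where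
  open ≡-Reasoning
  Q = λ n → DzPow n yP
  k = suc j
  2k≤n = half-bound n k k≤
  j≤ = ℕP.≤-trans (ℕP.n≤1+n j) k≤
  m = n ℕ.∸ 2 ℕ.* k
  B = n ℕ.+ 2 ℕ.* j
  exponent : 3 ℕ.+ B ≡ n ℕ.+ 2 ℕ.* k ℕ.+ 1
  exponent = solve 2 (λ n j → con 3 :+ (n :+ con 2 :* j)
                            := n :+ con 2 :* (con 1 :+ j) :+ con 1) refl n j
  current : Q n (suc m) (2 ℕ.+ B) ≡ N n (+ k)
  current = sym (trans (N-coeff n k (half-mono k (ℕP.n≤1+n n) k≤))
                       (cong₂ (Q n) (ℕP.+-∸-assoc 1 2k≤n) (+2*suc n j)))
  previous : Q n (3 ℕ.+ m) B ≡ N n (+ j)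
  previous = sym (trans (N-coeff n j (half-mono j (ℕP.n≤1+n n) j≤))
                        (cong (λ e → Q n e B)
                              (trans (ℕP.+-∸-assoc 1 (half-bound n j j≤))
                                     (cong suc (∸2*suc n j 2k≤n)))))

theorem1 : ((n k : ℕ) → k ≤ n ℕ./ 2 →
              M (suc n) (+ k) ≡ ℤ→ℚ (+ n ℤ.+ + 2 ℤ.* + k ℤ.+ + 2) * M n (+ k)
                                + ℤ→ℚ (+ n ℤ.- + 2 ℤ.* + k ℤ.+ + 2) * M n (+ k ℤ.- + 1))
           × M 0 (+ 0) ≡ 1ℚ
           × ((k : ℕ) → 1 ≤ k → M 0 (+ k) ≡ 0ℚ)
           × ((n k : ℕ) → k ≤ n ℕ./ 2 →
              N (suc n) (+ k) ≡ ℤ→ℚ (+ n ℤ.+ + 2 ℤ.* + k ℤ.+ + 1) * N n (+ k)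
                                + ℤ→ℚ (+ n ℤ.- + 2 ℤ.* + k ℤ.+ + 3) * N n (+ k ℤ.- + 1))
           × N 0 (+ 0) ≡ 1ℚ
           × ((k : ℕ) → 1 ≤ k → N 0 (+ k) ≡ 0ℚ)
theorem1 = M-recurrence , refl , M-initial , N-recurrence , refl , N-initial
  where
  M-initial : (k : ℕ) → 1 ≤ k → M 0 (+ k) ≡ 0ℚ
  M-initial (suc k) _ = refl
  N-initial : (k : ℕ) → 1 ≤ k → N 0 (+ k) ≡ 0ℚ
  N-initial (suc k) _ = refl
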